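{- Let $n\ge1$ and let $a_{ij}$ ($i=0,\dots,n$, $j=1,\dots,n$) be positive integers with $a_{0j}\le\dots\le a_{n-1,j}$ for every $j$; let $\mathcal{A}_i=\{b\in\mathbb{Z}^n:0\le b_j\le a_{ij}\}$ with $\mathcal{B}$, $t_b$, $\mathcal{G}$, $I_b$, $g_b$ as in the context. If $b\in\mathcal{G}$ and $g_b=0$, then $b$ lies in a (translated) mixed cell.
   Context: $\Delta_i=\mathrm{conv}(\mathcal{A}_i)$, $\Delta=\sum_i\Delta_i$. Fix $v\in\mathbb{R}^n$ with all $v_j<0$ and sufficiently small reals $\lambda_0>\dots>\lambda_n\ge0$; the lifting $\omega_i(x)=\lambda_i\langle v,x\rangle$ on $\mathcal{A}_i$ induces a coherent mixed subdivision $S(\rho)$ of $\Delta$ with cells $D=D_0+\dots+D_n$. Fix $\delta\in\mathbb{R}^n$ with all coordinates negative and sufficiently small (generic), $\mathcal{B}=(\Delta+\delta)\cap\mathbb{Z}^n$. For $b$ in a translated $n$-cell $D+\delta$, $t_{b,i}=\dim D_i$ (so $\sum_it_{b,i}=n$); $b$ lies in a mixed cell if exactly one $t_{b,i}$ equals $0$, otherwise in a non-mixed cell. $\mathcal{G}=\{b\in\mathcal{B}:\sum_{i=0}^It_{b,i}\le I+1\ \forall I<n\}$. $I_b=\max\{i:t_{b,i}\ge2\}$ if $b$ is in a non-mixed cell and $I_b=0$ if in a mixed cell; $g_b=|\{i<I_b:t_{b,i}=0\}|$. -}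

module Defs where

open import Data.Nat using (ℕ; zero; suc; _≤_; _<_; _<?_)
open import Data.Nat.Properties using (_≟_)
open import Data.Fin using (Fin; toℕ; inject₁)
open import Data.List using (List; length; filter; map; allFin)
open import Data.Nat.ListAction using (sum)
open import Data.Product using (_×_; Σ)
open import Data.Sum using (_⊎_)
open import Relation.Nullary using (¬_)
open import Relation.Nullary.Decidable using (_×-dec_)
open import Relation.Unary using (Pred; Decidable)
open import Relation.Binary.PropositionalEquality using (_≡_)

count : ∀ {m} {P : Pred (Fin m) Agda.Primitive.lzero} → Decidable P → ℕ
count {m} P? = length (filter P? (allFin m))

sumBelow : ∀ {m} → (Fin m → ℕ) → ℕ → ℕ
sumBelow {m} f k = sum (map f (filter (λ i → toℕ i <? k) (allFin m)))

-- Data of the theorem: a i j for i = 0..n (Fin (suc n)), j = 1..n (Fin n).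
Positive : ∀ {n} → (Fin (suc n) → Fin n → ℕ) → Set
Positive a = ∀ i j → 1 ≤ a i j

MonotoneRows : ∀ {n} → (Fin (suc n) → Fin n → ℕ) → Set
MonotoneRows {n} a =
  ∀ (j : Fin n) (i i' : Fin n) → toℕ i ≤ toℕ i' → a (inject₁ i) j ≤ a (inject₁ i') j

-- b ∈ 𝓑 = (Δ + δ) ∩ ℤⁿ, Δ = ∏_j [0, Σ_i a_ij], δ small negative generic:
-- exactly the integer points with 0 ≤ b_j ≤ Σ_i a_ij - 1.
InB : ∀ {n} → (Fin (suc n) → Fin n → ℕ) → (Fin n → ℕ) → Set
InB {n} a b = ∀ j → b j < sumBelow (λ i → a i j) (suc n)

-- The n-cells of S(ρ): for the linear liftings ω_i = λ_i⟨v,·⟩ on the boxes 𝓐_i,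
-- an n-cell D = D_0+...+D_n is given by k : Fin n → Fin (suc n) with
-- D = ∏_j [Σ_{i<k_j} a_ij , Σ_{i≤k_j} a_ij], D_i = ∏_{j : k_j = i} [0,a_ij] × (point).
-- b ∈ D + δ (δ small negative generic) iff
-- Σ_{i<k_j} a_ij ≤ b_j < Σ_{i≤k_j} a_ij for all j.
InCell : ∀ {n} → (Fin (suc n) → Fin n → ℕ) → (Fin n → ℕ) → (Fin n → Fin (suc n)) → Set
InCell a b k = ∀ j →
  (sumBelow (λ i → a i j) (toℕ (k j)) ≤ b j) ×
  (b j < sumBelow (λ i → a i j) (suc (toℕ (k j))))

-- t_{b,i} = dim D_i = #{ j : k_j = i }
tvec : ∀ {n} → (Fin n → Fin (suc n)) → Fin (suc n) → ℕ
tvec k i = count (λ j → toℕ (k j) ≟ toℕ i)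

Mixed : ∀ {n} → (Fin (suc n) → ℕ) → Set
Mixed t = count (λ i → t i ≟ 0) ≡ 1

InG : ∀ {n} → (Fin (suc n) → ℕ) → Set
InG {n} t = ∀ (I : Fin n) → sumBelow t (suc (toℕ I)) ≤ suc (toℕ I)

IsIb : ∀ {n} → (Fin (suc n) → ℕ) → Fin (suc n) → Set
IsIb t I =
  (Mixed t × toℕ I ≡ 0) ⊎
  (¬ Mixed t × (2 ≤ t I) × (∀ i → toℕ I < toℕ i → t i < 2))

gval : ∀ {n} → (Fin (suc n) → ℕ) → Fin (suc n) → ℕ
gval t I = count (λ i → ((toℕ i <? toℕ I) ×-dec (t i ≟ 0)))

{-# OPTIONS --safe #-}
-- The geometry enters only through the vector t = tvec k, which sums to n.  If b
-- lay in a non-mixed cell, g_b = 0 would make t_i ≥ 1 for i < I_b, and t_{I_b} ≥ 2,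
-- so the prefix sum Σ_{i ≤ I_b} t_i would be at least I_b + 2.  This violates the
-- defining inequality of 𝓖 when I_b < n, and the total Σ t = n when I_b = n.
module Submission where

open import Defs
open import Data.Bool using (true; false; if_then_else_)
open import Data.Empty using (⊥-elim)
open import Data.Fin using (Fin; zero; suc; toℕ; fromℕ<)
open import Data.Fin.Properties using (toℕ-injective; toℕ-fromℕ<; toℕ<n)
open import Data.List using (List; []; _∷_; length; filter; map; allFin; tabulate)
open import Data.List.Membership.Propositional using (lose)
open import Data.List.Membership.Propositional.Properties using (∈-allFin)
open import Data.List.Properties using (filter-some)
import Data.Nat.ListAction as List
open import Data.Nat using (ℕ; zero; suc; _+_; _≤_; _<_; _≥_; _<?_; z≤n; s≤s)
open import Data.Nat.Properties
open import Data.Product using (_×_; _,_; ∃)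
open import Data.Sum using (inj₁; inj₂)
open import Function using (const)
open import Level using (0ℓ)
open import Relation.Binary.PropositionalEquality
  using (_≡_; refl; sym; trans; cong; subst; module ≡-Reasoning)
open import Relation.Nullary using (Dec; yes; no; does; ¬_)
open import Relation.Nullary.Decidable using (_×-dec_)
open import Relation.Unary using (Pred; Decidable)

open import Algebra.Properties.CommutativeMonoid.Sum (+-0-commutativeMonoid)
  using (sum; sum-syntax; sum-cong-≗; ∑-comm)

infix 3 _when_

_when_ : ∀ {p} {P : Set p} → ℕ → Dec P → ℕ
x when d = if does d then x else 0

when-≤ : ∀ {p} {P : Set p} (x : ℕ) (d : Dec P) → (x when d) ≤ x
when-≤ x (yes _) = ≤-refl
when-≤ x (no _)  = z≤n

when-mono-≤ : ∀ {p} {P : Set p} {x y : ℕ} (d : Dec P) → (P → x ≤ y) → (x when d) ≤ (y when d)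
when-mono-≤ (yes p) x≤y = x≤y p
when-mono-≤ (no _)  _   = ≤-refl

when-mono-< : ∀ {p} {P : Set p} {x y : ℕ} (d : Dec P) → P → x < y → (x when d) < (y when d)
when-mono-< (yes _) _ x<y = x<y
when-mono-< (no ¬p) p _   = ⊥-elim (¬p p)

∑-mono-≤ : ∀ {m} {f g : Fin m → ℕ} → (∀ i → f i ≤ g i) → sum f ≤ sum g
∑-mono-≤ {zero}  f≤g = z≤n
∑-mono-≤ {suc m} f≤g = +-mono-≤ (f≤g zero) (∑-mono-≤ (λ i → f≤g (suc i)))

∑-mono-< : ∀ {m} {f g : Fin m → ℕ} → (∀ i → f i ≤ g i) → ∀ j → f j < g j → sum f < sum g
∑-mono-< {suc m} f≤g zero    fj<gj = +-mono-<-≤ fj<gj (∑-mono-≤ (λ i → f≤g (suc i)))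
∑-mono-< {suc m} f≤g (suc j) fj<gj = +-mono-≤-< (f≤g zero) (∑-mono-< (λ i → f≤g (suc i)) j fj<gj)

∑-ones : ∀ m → ∑[ i < m ] 1 ≡ m
∑-ones zero    = refl
∑-ones (suc m) = cong suc (∑-ones m)

∑-zeros : ∀ m → ∑[ i < m ] 0 ≡ 0
∑-zeros zero    = refl
∑-zeros (suc m) = ∑-zeros m

∑-delta : ∀ {p} (x : Fin p) → ∑[ i < p ] (1 when toℕ x ≟ toℕ i) ≡ 1
∑-delta {suc p} zero    = cong suc (∑-zeros p)
∑-delta {suc p} (suc x) = ∑-delta x

∑-prefix-ones : ∀ {m} c → c ≤ m → ∑[ i < m ] (1 when toℕ i <? c) ≡ c
∑-prefix-ones {m}     zero    _         = ∑-zeros m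
∑-prefix-ones {suc m} (suc c) (s≤s c≤m) = cong suc (∑-prefix-ones c c≤m)

sum-map-filter : ∀ {A : Set} {P : Pred A 0ℓ} (P? : Decidable P) (f : A → ℕ) (xs : List A) →
  List.sum (map f (filter P? xs)) ≡ List.sum (map (λ x → f x when P? x) xs)
sum-map-filter P? f []       = refl
sum-map-filter P? f (x ∷ xs) with does (P? x)
... | true  = cong (f x +_) (sum-map-filter P? f xs)
... | false = sum-map-filter P? f xs

sum-map-tabulate : ∀ {A : Set} {m} (f : A → ℕ) (g : Fin m → A) →
  List.sum (map f (tabulate g)) ≡ ∑[ i < m ] f (g i)
sum-map-tabulate {m = zero}  f g = refl
sum-map-tabulate {m = suc m} f g = cong (f (g zero) +_) (sum-map-tabulate f (λ i → g (suc i)))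

length≡sum-map-1 : ∀ {A : Set} (xs : List A) → length xs ≡ List.sum (map (const 1) xs)
length≡sum-map-1 []       = refl
length≡sum-map-1 (x ∷ xs) = cong suc (length≡sum-map-1 xs)

sumBelow≡∑ : ∀ {m} (f : Fin m → ℕ) c → sumBelow f c ≡ ∑[ i < m ] (f i when toℕ i <? c)
sumBelow≡∑ {m} f c =
  trans (sum-map-filter (λ i → toℕ i <? c) f (allFin m))
        (sum-map-tabulate (λ i → f i when toℕ i <? c) (λ i → i))

sumBelow-≤-∑ : ∀ {m} (f : Fin m → ℕ) c → sumBelow f c ≤ sum f
sumBelow-≤-∑ f c =
  ≤-trans (≤-reflexive (sumBelow≡∑ f c)) (∑-mono-≤ {g = f} (λ i → when-≤ (f i) (toℕ i <? c)))

count≡∑ : ∀ {m} {P : Pred (Fin m) 0ℓ} (P? : Decidable P) → count P? ≡ ∑[ i < m ] (1 when P? i)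
count≡∑ {m} P? = begin
  length (filter P? (allFin m))
    ≡⟨ length≡sum-map-1 (filter P? (allFin m)) ⟩
  List.sum (map (const 1) (filter P? (allFin m)))
    ≡⟨ sum-map-filter P? (const 1) (allFin m) ⟩
  List.sum (map (λ i → 1 when P? i) (allFin m))
    ≡⟨ sum-map-tabulate (λ i → 1 when P? i) (λ i → i) ⟩
  ∑[ i < m ] (1 when P? i) ∎
  where open ≡-Reasoning

count≡0⇒∁ : ∀ {m} {P : Pred (Fin m) 0ℓ} (P? : Decidable P) → count P? ≡ 0 → ∀ i → ¬ P i
count≡0⇒∁ P? count≡0 i p = <⇒≢ (filter-some P? (lose (∈-allFin i) p)) (sym count≡0)

∑-count-fibres : ∀ {m p} (k : Fin m → Fin p) →
  ∑[ i < p ] count (λ j → toℕ (k j) ≟ toℕ i) ≡ m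
∑-count-fibres {m} {p} k = begin
  ∑[ i < p ] count (λ j → toℕ (k j) ≟ toℕ i)
    ≡⟨ sum-cong-≗ {p} (λ i → count≡∑ (λ j → toℕ (k j) ≟ toℕ i)) ⟩
  ∑[ i < p ] ∑[ j < m ] (1 when toℕ (k j) ≟ toℕ i)
    ≡⟨ ∑-comm {p} {m} (λ i j → 1 when toℕ (k j) ≟ toℕ i) ⟩
  ∑[ j < m ] ∑[ i < p ] (1 when toℕ (k j) ≟ toℕ i)
    ≡⟨ sum-cong-≗ (λ j → ∑-delta (k j)) ⟩
  ∑[ j < m ] 1
    ≡⟨ ∑-ones m ⟩
  m ∎
  where open ≡-Reasoning

prefix-sum-lower-bound : ∀ {m} (t : Fin m → ℕ) (I : Fin m) →
  (∀ i → toℕ i < toℕ I → 1 ≤ t i) → 2 ≤ t I → suc (toℕ I) < sumBelow t (suc (toℕ I))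
prefix-sum-lower-bound {m} t I positive 2≤tI = begin-strict
  suc (toℕ I)
    ≡⟨ sym (∑-prefix-ones (suc (toℕ I)) (toℕ<n I)) ⟩
  ∑[ i < m ] (1 when toℕ i <? suc (toℕ I))
    <⟨ ∑-mono-< ones≤t I (when-mono-< (toℕ I <? suc (toℕ I)) ≤-refl 2≤tI) ⟩
  ∑[ i < m ] (t i when toℕ i <? suc (toℕ I))
    ≡⟨ sym (sumBelow≡∑ t (suc (toℕ I))) ⟩
  sumBelow t (suc (toℕ I)) ∎
  where
  open ≤-Reasoning
  positive-upTo-I : ∀ i → toℕ i ≤ toℕ I → 1 ≤ t i
  positive-upTo-I i i≤I with m≤n⇒m<n∨m≡n i≤I
  ... | inj₁ i<I = positive i i<I
  ... | inj₂ i≡I rewrite toℕ-injective i≡I = ≤-trans (s≤s z≤n) 2≤tI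

  ones≤t : ∀ i → (1 when toℕ i <? suc (toℕ I)) ≤ (t i when toℕ i <? suc (toℕ I))
  ones≤t i = when-mono-≤ (toℕ i <? suc (toℕ I)) (λ i<1+I → positive-upTo-I i (≤-pred i<1+I))

gval≡0⇒positive-below : ∀ {n} (t : Fin (suc n) → ℕ) (I : Fin (suc n)) →
  gval t I ≡ 0 → ∀ i → toℕ i < toℕ I → 1 ≤ t i
gval≡0⇒positive-below t I g≡0 i i<I =
  n≢0⇒n>0 (λ ti≡0 → count≡0⇒∁ (λ j → (toℕ j <? toℕ I) ×-dec (t j ≟ 0)) g≡0 i (i<I , ti≡0))

InG⇒prefix-sum-bound : ∀ {n} (k : Fin n → Fin (suc n)) → InG (tvec k) →
  ∀ (I : Fin (suc n)) → sumBelow (tvec k) (suc (toℕ I)) ≤ suc (toℕ I)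
InG⇒prefix-sum-bound {n} k inG I with toℕ I <? n
... | yes I<n =
  subst (λ c → sumBelow (tvec k) (suc c) ≤ suc c) (toℕ-fromℕ< I<n) (inG (fromℕ< I<n))
... | no I≮n = begin
  sumBelow (tvec k) (suc (toℕ I))  ≤⟨ sumBelow-≤-∑ (tvec k) (suc (toℕ I)) ⟩
  sum (tvec k)                     ≡⟨ ∑-count-fibres k ⟩
  n                                ≤⟨ ≮⇒≥ I≮n ⟩
  toℕ I                            ≤⟨ n≤1+n _ ⟩
  suc (toℕ I)                      ∎
  where open ≤-Reasoning

lemma3p11 : (n : ℕ) → n ≥ 1 →
    (a : Fin (suc n) → Fin n → ℕ) → Positive a → MonotoneRows a →
    (b : Fin n → ℕ) → InB a b →
    (k : Fin n → Fin (suc n)) → InCell a b k →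
    InG (tvec k) →
    ∃ (λ I → IsIb (tvec k) I × gval (tvec k) I ≡ 0) →
    Mixed (tvec k)
lemma3p11 _ _ _ _ _ _ _ k _ inG (I , inj₁ (mixed , _) , _) = mixed
lemma3p11 _ _ _ _ _ _ _ k _ inG (I , inj₂ (_ , 2≤tI , _) , g≡0) =
  ⊥-elim (<⇒≱ (prefix-sum-lower-bound (tvec k) I positive-below 2≤tI)
              (InG⇒prefix-sum-bound k inG I))
  where
  positive-below : ∀ i → toℕ i < toℕ I → 1 ≤ tvec k i
  positive-below = gval≡0⇒positive-below (tvec k) I g≡0
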